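{- For $0\le k\le N$, the coefficient of $\beta^ky^k$ in $\bar Z_N(1,\beta,y,q)$ is $S_2[N+1,k+1]$.
   Context: Let $\mathcal A$ be the associative algebra over $\mathbb Z[y,q]$ generated by $D,E$ subject to $DE-qED=D+E$; every element is uniquely a finite $\mathbb Z[y,q]$-combination of words $E^iD^j$, and we write $(yD+E)^N=\sum_{i,j}c^{(N)}_{i,j}E^iD^j$. Define $\bar Z_N(\alpha,\beta,y,q)=\sum_{i,j}c^{(N)}_{i,j}\alpha^{i}\beta^{j}$ (the PASEP partition function with $\alpha,\beta$ replaced by $1/\alpha,1/\beta$). The Carlitz $q$-Stirling numbers of the second kind $S_2[n,k]$ ($1\le k\le n$) are defined by $S_2[n,k]=1$ if $k=1$ or $k=n$, and $S_2[n,k]=S_2[n-1,k-1]+[k]_qS_2[n-1,k]$ otherwise, where $[k]_q=1+q+\dots+q^{k-1}$. -}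

module Defs where

open import Data.Nat using (ℕ; zero; suc; _≟_)
import Data.Nat as ℕ
open import Data.Integer using (ℤ; 0ℤ; 1ℤ; _+_; _*_)
open import Data.List using (List; []; _∷_; _++_; map; concatMap; replicate; foldr)
open import Data.Bool using (Bool; true; false; _∧_; if_then_else_)
open import Relation.Nullary.Decidable using (⌊_⌋; yes; no)

-- Polynomials in q with integer coefficients, as coefficient lists
-- (constant term first).  Equality is compared coefficientwise (qcoeff).

QPoly : Set
QPoly = List ℤ

infixl 6 _+P_
infixl 7 _*P_

_+P_ : QPoly → QPoly → QPoly
[] +P p = p
(a ∷ p) +P [] = a ∷ p
(a ∷ p) +P (b ∷ r) = (a + b) ∷ (p +P r)

_*P_ : QPoly → QPoly → QPoly
[] *P r = []
(a ∷ p) *P r = map (a *_) r +P (0ℤ ∷ (p *P r))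

qcoeff : QPoly → ℕ → ℤ
qcoeff [] m = 0ℤ
qcoeff (a ∷ p) zero = a
qcoeff (a ∷ p) (suc m) = qcoeff p m

monoP : ℤ → ℕ → QPoly
monoP c b = replicate b 0ℤ ++ (c ∷ [])

qint : ℕ → QPoly
qint k = replicate k 1ℤ

-- S2 n k is S_2[n,k]; only meaningful for 1 ≤ k ≤ n (junk [] = 0 otherwise
-- when an argument is 0).

S2 : ℕ → ℕ → QPoly
S2 zero _ = []
S2 (suc n) zero = []
S2 (suc n) (suc k) with k ≟ 0 | k ≟ n
... | yes _ | _     = 1ℤ ∷ []
... | no _  | yes _ = 1ℤ ∷ []
... | no _  | no _  = S2 n k +P qint (suc k) *P S2 n (suc k)

-- The algebra A over Z[y,q] generated by D,E with DE - qED = D + E,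
-- represented in its normal-ordered basis E^i D^j.  An element is a
-- finite formal sum (list) of terms  c * y^a * q^b * E^i D^j  with c ∈ ℤ.

record Term : Set where
  constructor term
  field
    coef : ℤ
    yexp : ℕ
    qexp : ℕ
    eexp : ℕ
    dexp : ℕ

Elt : Set
Elt = List Term

-- normal form of D^j E, using D^(j+1) E = q (D^j E) D + D^(j+1) + D^j E
-- (from DE = qED + D + E).
DjE : ℕ → Elt
DjE zero = term 1ℤ 0 0 1 0 ∷ []
DjE (suc j) =
  map (λ t → term (Term.coef t) (Term.yexp t) (suc (Term.qexp t))
                  (Term.eexp t) (suc (Term.dexp t))) (DjE j)
  ++ (term 1ℤ 0 0 0 (suc j) ∷ [])
  ++ DjE j

mulYD : Term → Term
mulYD (term c a b i j) = term c (suc a) b i (suc j)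

mulE : Term → Elt
mulE (term c a b i j) =
  map (λ t → term (c * Term.coef t) (a ℕ.+ Term.yexp t) (b ℕ.+ Term.qexp t)
                  (i ℕ.+ Term.eexp t) (Term.dexp t)) (DjE j)

yDEpow : ℕ → Elt
yDEpow zero = term 1ℤ 0 0 0 0 ∷ []
yDEpow (suc N) = concatMap (λ t → mulYD t ∷ mulE t) (yDEpow N)

-- Zbar_N(α,β,y,q) = Σ c_{i,j} α^i β^j.  Setting α = 1, the coefficient of
-- β^k y^k is the polynomial in q obtained by summing c q^b over all terms
-- with D-exponent j = k and y-exponent a = k (any i).

coeffβkyk-Zbar1 : ℕ → ℕ → QPoly
coeffβkyk-Zbar1 N k =
  foldr (λ t acc → if ⌊ Term.dexp t ≟ k ⌋ ∧ ⌊ Term.yexp t ≟ k ⌋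
                     then monoP (Term.coef t) (Term.qexp t) +P acc
                     else acc)
        [] (yDEpow N)

-- Let F_N(k) be the coefficient of y^k D^k in (yD + E)^N, summed over all powers of E.  Every term
-- y^a E^i D^j of (yD + E)^N has j ≤ a ≤ N.  Right multiplication by yD raises a and j by one; right
-- multiplication by E turns y^a E^i D^j into y^a E^i D^j E, and by DE = qED + D + E the terms of D^j E
-- have at most j D's, the ones with exactly j summing to [j+1]_q E D^j.  As j ≤ a, only terms with
-- j = a = k feed the y^k D^k coefficient, so F_{N+1}(k) = F_N(k-1) + [k+1]_q F_N(k), with F_0(0) = 1 and
-- F_N(k) = 0 for k > N: the Carlitz recurrence for S_2[N+2, k+1].

module Submission where

open import Defs
open import Data.Bool using (Bool; true; false; _∧_; if_then_else_)
open import Data.Empty using (⊥-elim)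
open import Data.Integer using (ℤ; 0ℤ; 1ℤ; _+_; _*_)
open import Data.Integer.Properties using (+-identityˡ; +-identityʳ; *-identityˡ; *-identityʳ; *-zeroʳ; *-distribˡ-+; +-assoc; +-commutativeSemigroup)
open import Algebra.Properties.CommutativeSemigroup +-commutativeSemigroup using (interchange)
open import Data.List using ([]; _∷_; _++_; map; concatMap; foldr)
open import Data.List.Relation.Unary.All using (All; []; _∷_)
import Data.List.Relation.Unary.All as All
open import Data.List.Relation.Unary.All.Properties using (map⁺; ++⁺; concat⁺)
open import Data.Nat using (ℕ; zero; suc; _≤_; _<_; _≡ᵇ_; _≟_; z≤n; s≤s)
import Data.Nat as ℕ
import Data.Nat.Properties as ℕP
open import Data.Product using (_×_; _,_; proj₁)
open import Data.Sum using (inj₁; inj₂)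
open import Relation.Nullary using (yes; no)
open import Relation.Nullary.Decidable using (⌊_⌋)
open import Relation.Binary.PropositionalEquality using (_≡_; _≢_; refl; sym; trans; cong; cong₂)
open Relation.Binary.PropositionalEquality.≡-Reasoning

keepIf : Bool → ℤ → ℤ
keepIf true  x = x
keepIf false _ = 0ℤ

keepIf-0ℤ : ∀ b → keepIf b 0ℤ ≡ 0ℤ
keepIf-0ℤ true  = refl
keepIf-0ℤ false = refl

keepIf-* : ∀ b c x → keepIf b (c * x) ≡ c * keepIf b x
keepIf-* true  c x = refl
keepIf-* false c x = sym (*-zeroʳ c)

≡ᵇ-refl : ∀ n → (n ≡ᵇ n) ≡ true
≡ᵇ-refl zero    = refl
≡ᵇ-refl (suc n) = ≡ᵇ-refl n

≢⇒≡ᵇ-false : ∀ {m n} → m ≢ n → (m ≡ᵇ n) ≡ false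
≢⇒≡ᵇ-false {zero}  {zero}  m≢n = ⊥-elim (m≢n refl)
≢⇒≡ᵇ-false {zero}  {suc n} m≢n = refl
≢⇒≡ᵇ-false {suc m} {zero}  m≢n = refl
≢⇒≡ᵇ-false {suc m} {suc n} m≢n = ≢⇒≡ᵇ-false (λ m≡n → m≢n (cong suc m≡n))

⌊≟⌋≡≡ᵇ : ∀ m n → ⌊ m ≟ n ⌋ ≡ (m ≡ᵇ n)
⌊≟⌋≡≡ᵇ m n with m ≟ n
... | yes refl = sym (≡ᵇ-refl m)
... | no m≢n   = sym (≢⇒≡ᵇ-false m≢n)

-- Coefficients of [k]_q · f for a q-series f given by its coefficients.
qintTimes : ℕ → (ℕ → ℤ) → ℕ → ℤ
qintTimes zero    f m       = 0ℤ
qintTimes (suc k) f zero    = f zero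
qintTimes (suc k) f (suc m) = f (suc m) + qintTimes k f m

qintTimes-cong : ∀ k {f g} → (∀ x → f x ≡ g x) → ∀ m → qintTimes k f m ≡ qintTimes k g m
qintTimes-cong zero    f≗g m       = refl
qintTimes-cong (suc k) f≗g zero    = f≗g zero
qintTimes-cong (suc k) f≗g (suc m) = cong₂ _+_ (f≗g (suc m)) (qintTimes-cong k f≗g m)

qintTimes-0ℤ : ∀ k {f} → (∀ x → f x ≡ 0ℤ) → ∀ m → qintTimes k f m ≡ 0ℤ
qintTimes-0ℤ zero    f≗0 m       = refl
qintTimes-0ℤ (suc k) f≗0 zero    = f≗0 zero
qintTimes-0ℤ (suc k) f≗0 (suc m) = cong₂ _+_ (f≗0 (suc m)) (qintTimes-0ℤ k f≗0 m)

qintTimes-+ : ∀ k f g m → qintTimes k (λ x → f x + g x) m ≡ qintTimes k f m + qintTimes k g m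
qintTimes-+ zero    f g m       = refl
qintTimes-+ (suc k) f g zero    = refl
qintTimes-+ (suc k) f g (suc m) =
  trans (cong (f (suc m) + g (suc m) +_) (qintTimes-+ k f g m))
        (interchange (f (suc m)) (g (suc m)) (qintTimes k f m) (qintTimes k g m))

*-qintTimes : ∀ k c f m → c * qintTimes k f m ≡ qintTimes k (λ x → c * f x) m
*-qintTimes zero    c f m       = *-zeroʳ c
*-qintTimes (suc k) c f zero    = refl
*-qintTimes (suc k) c f (suc m) =
  trans (*-distribˡ-+ c (f (suc m)) (qintTimes k f m)) (cong (c * f (suc m) +_) (*-qintTimes k c f m))

qintTimes-suc : ∀ k f → f zero ≡ 0ℤ → ∀ m → qintTimes k f (suc m) ≡ qintTimes k (λ x → f (suc x)) m
qintTimes-suc zero          f f0≡0 m       = refl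
qintTimes-suc (suc zero)    f f0≡0 zero    = +-identityʳ (f 1)
qintTimes-suc (suc (suc k)) f f0≡0 zero    = trans (cong (f 1 +_) f0≡0) (+-identityʳ (f 1))
qintTimes-suc (suc k)       f f0≡0 (suc m) = cong (f (suc (suc m)) +_) (qintTimes-suc k f f0≡0 m)

qintTimes-1 : ∀ f m → qintTimes 1 f m ≡ f m
qintTimes-1 f zero    = refl
qintTimes-1 f (suc m) = +-identityʳ (f (suc m))

qcoeff-+P : ∀ p r m → qcoeff (p +P r) m ≡ qcoeff p m + qcoeff r m
qcoeff-+P []      r       m       = sym (+-identityˡ _)
qcoeff-+P (a ∷ p) []      m       = sym (+-identityʳ _)
qcoeff-+P (a ∷ p) (b ∷ r) zero    = refl
qcoeff-+P (a ∷ p) (b ∷ r) (suc m) = qcoeff-+P p r m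

qcoeff-monoP : ∀ c b m → qcoeff (monoP c b) m ≡ keepIf (b ≡ᵇ m) c
qcoeff-monoP c zero    zero    = refl
qcoeff-monoP c zero    (suc m) = refl
qcoeff-monoP c (suc b) zero    = refl
qcoeff-monoP c (suc b) (suc m) = qcoeff-monoP c b m

qcoeff-map-1ℤ* : ∀ r m → qcoeff (map (1ℤ *_) r) m ≡ qcoeff r m
qcoeff-map-1ℤ* []      m       = refl
qcoeff-map-1ℤ* (a ∷ r) zero    = *-identityˡ a
qcoeff-map-1ℤ* (a ∷ r) (suc m) = qcoeff-map-1ℤ* r m

qcoeff-qint-*P : ∀ k r m → qcoeff (qint k *P r) m ≡ qintTimes k (qcoeff r) m
qcoeff-qint-*P zero    r m       = refl
qcoeff-qint-*P (suc k) r zero    =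
  trans (qcoeff-+P (map (1ℤ *_) r) _ 0) (trans (+-identityʳ _) (qcoeff-map-1ℤ* r 0))
qcoeff-qint-*P (suc k) r (suc m) =
  trans (qcoeff-+P (map (1ℤ *_) r) _ (suc m)) (cong₂ _+_ (qcoeff-map-1ℤ* r (suc m)) (qcoeff-qint-*P k r m))

-- coeff e a j b is the coefficient of y^a D^j q^b in e, summed over all powers of E (that is, α = 1).
-- Exponents are compared with _≡ᵇ_ so that shifting an exponent by suc is a definitional step.
termCoeff : Term → ℕ → ℕ → ℕ → ℤ
termCoeff (term c a b i j) a′ j′ b′ = keepIf (b ≡ᵇ b′) (keepIf (j ≡ᵇ j′) (keepIf (a ≡ᵇ a′) c))

coeff : Elt → ℕ → ℕ → ℕ → ℤ
coeff []      a j b = 0ℤ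
coeff (t ∷ e) a j b = termCoeff t a j b + coeff e a j b

termCoeff-yexp≢ : ∀ t {a j b} → Term.yexp t ≢ a → termCoeff t a j b ≡ 0ℤ
termCoeff-yexp≢ (term c a b i j) {a′} {j′} {b′} a≢a′ = begin
  keepIf (b ≡ᵇ b′) (keepIf (j ≡ᵇ j′) (keepIf (a ≡ᵇ a′) c)) ≡⟨ cong (λ z → keepIf (b ≡ᵇ b′) (keepIf (j ≡ᵇ j′) (keepIf z c))) (≢⇒≡ᵇ-false a≢a′) ⟩
  keepIf (b ≡ᵇ b′) (keepIf (j ≡ᵇ j′) 0ℤ)                   ≡⟨ cong (keepIf (b ≡ᵇ b′)) (keepIf-0ℤ (j ≡ᵇ j′)) ⟩
  keepIf (b ≡ᵇ b′) 0ℤ                                      ≡⟨ keepIf-0ℤ (b ≡ᵇ b′) ⟩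
  0ℤ                                                       ∎

termCoeff-dexp≢ : ∀ t {a j b} → Term.dexp t ≢ j → termCoeff t a j b ≡ 0ℤ
termCoeff-dexp≢ (term c a b i j) {a′} {j′} {b′} j≢j′ =
  trans (cong (λ z → keepIf (b ≡ᵇ b′) (keepIf z (keepIf (a ≡ᵇ a′) c))) (≢⇒≡ᵇ-false j≢j′)) (keepIf-0ℤ (b ≡ᵇ b′))

coeff-++ : ∀ e f a j b → coeff (e ++ f) a j b ≡ coeff e a j b + coeff f a j b
coeff-++ []      f a j b = sym (+-identityˡ _)
coeff-++ (t ∷ e) f a j b =
  trans (cong (termCoeff t a j b +_) (coeff-++ e f a j b)) (sym (+-assoc (termCoeff t a j b) _ _))

coeff-vanishes : ∀ {e a j b} → All (λ t → termCoeff t a j b ≡ 0ℤ) e → coeff e a j b ≡ 0ℤ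
coeff-vanishes []           = refl
coeff-vanishes (t≡0 ∷ e≡0) = cong₂ _+_ t≡0 (coeff-vanishes e≡0)

coeff-map : ∀ (f : Term → Term) e {a j b a′ j′ b′} →
  (∀ t → termCoeff (f t) a j b ≡ termCoeff t a′ j′ b′) → coeff (map f e) a j b ≡ coeff e a′ j′ b′
coeff-map f []      f≗ = refl
coeff-map f (t ∷ e) f≗ = cong₂ _+_ (f≗ t) (coeff-map f e f≗)

coeff-map-cong : ∀ (f g : Term → Term) e {a j b a′ j′ b′} →
  (∀ t → termCoeff (f t) a j b ≡ termCoeff (g t) a′ j′ b′) → coeff (map f e) a j b ≡ coeff (map g e) a′ j′ b′
coeff-map-cong f g []      f≗g = refl
coeff-map-cong f g (t ∷ e) f≗g = cong₂ _+_ (f≗g t) (coeff-map-cong f g e f≗g)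

coeff-map-0ℤ : ∀ (f : Term → Term) e {a j b} → (∀ t → termCoeff (f t) a j b ≡ 0ℤ) → coeff (map f e) a j b ≡ 0ℤ
coeff-map-0ℤ f []      f≗0 = refl
coeff-map-0ℤ f (t ∷ e) f≗0 = cong₂ _+_ (f≗0 t) (coeff-map-0ℤ f e f≗0)

coeff-map-* : ∀ (f : Term → Term) c e {a j b} →
  (∀ t → termCoeff (f t) a j b ≡ c * termCoeff t a j b) → coeff (map f e) a j b ≡ c * coeff e a j b
coeff-map-* f c []      f≗ = sym (*-zeroʳ c)
coeff-map-* f c (t ∷ e) f≗ =
  trans (cong₂ _+_ (f≗ t) (coeff-map-* f c e f≗)) (sym (*-distribˡ-+ c (termCoeff t _ _ _) _))

timesqD : Term → Term
timesqD (term c a b i j) = term c a (suc b) i (suc j)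

DjE-support : ∀ j → All (λ t → Term.yexp t ≡ 0 × Term.dexp t ≤ j) (DjE j)
DjE-support zero    = (refl , z≤n) ∷ []
DjE-support (suc j) =
  ++⁺ (map⁺ (All.map (λ { {term c a b i d} (a≡0 , d≤j) → a≡0 , s≤s d≤j }) (DjE-support j)))
      ((refl , ℕP.≤-refl) ∷ All.map (λ { (a≡0 , d≤j) → a≡0 , ℕP.m≤n⇒m≤1+n d≤j }) (DjE-support j))

coeff-DjE-above : ∀ j {a d m} → j < d → coeff (DjE j) a d m ≡ 0ℤ
coeff-DjE-above j j<d = coeff-vanishes
  (All.map (λ { {t} (_ , dexp≤j) → termCoeff-dexp≢ t (ℕP.<⇒≢ (ℕP.≤-<-trans dexp≤j j<d)) }) (DjE-support j))

coeff-DjE-top : ∀ j m → coeff (DjE j) 0 j m ≡ qintTimes (suc j) (qcoeff (1ℤ ∷ [])) m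
coeff-DjE-top zero    zero    = refl
coeff-DjE-top zero    (suc m) = refl
coeff-DjE-top (suc j) m = begin
  coeff (DjE (suc j)) 0 (suc j) m
    ≡⟨ coeff-++ (map timesqD (DjE j)) _ 0 (suc j) m ⟩
  shifted m + (keepIf (0 ≡ᵇ m) (keepIf (j ≡ᵇ j) 1ℤ) + coeff (DjE j) 0 (suc j) m)
    ≡⟨ cong₂ (λ u v → shifted m + (keepIf (0 ≡ᵇ m) (keepIf u 1ℤ) + v)) (≡ᵇ-refl j) (coeff-DjE-above j ℕP.≤-refl) ⟩
  shifted m + (keepIf (0 ≡ᵇ m) 1ℤ + 0ℤ)
    ≡⟨ split m ⟩
  qintTimes (suc (suc j)) (qcoeff (1ℤ ∷ [])) m ∎
  where
  shifted : ℕ → ℤ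
  shifted m = coeff (map timesqD (DjE j)) 0 (suc j) m

  split : ∀ m → shifted m + (keepIf (0 ≡ᵇ m) 1ℤ + 0ℤ) ≡ qintTimes (suc (suc j)) (qcoeff (1ℤ ∷ [])) m
  split zero    = cong (_+ 1ℤ) (coeff-map-0ℤ timesqD (DjE j) (λ { (term c a b i d) → refl }))
  split (suc m) = begin
    shifted (suc m) + (0ℤ + 0ℤ)                      ≡⟨ +-identityʳ _ ⟩
    shifted (suc m)                                  ≡⟨ coeff-map timesqD (DjE j) (λ { (term c a b i d) → refl }) ⟩
    coeff (DjE j) 0 j m                              ≡⟨ coeff-DjE-top j m ⟩
    qintTimes (suc j) (qcoeff (1ℤ ∷ [])) m           ≡⟨ sym (+-identityˡ _) ⟩
    qintTimes (suc (suc j)) (qcoeff (1ℤ ∷ [])) (suc m) ∎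

leftMul : ℤ → ℕ → ℕ → ℕ → Term → Term
leftMul c a b i (term c′ a′ b′ i′ j′) = term (c * c′) (a ℕ.+ a′) (b ℕ.+ b′) (i ℕ.+ i′) j′

mulE-support : ∀ c a b i j → All (λ t → Term.yexp t ≡ a × Term.dexp t ≤ j) (mulE (term c a b i j))
mulE-support c a b i j =
  map⁺ (All.map (λ { {term c′ a′ b′ i′ j′} (refl , j′≤j) → ℕP.+-identityʳ a , j′≤j }) (DjE-support j))

termCoeff-leftMul-unit : ∀ c i t {a j b} → termCoeff (leftMul c 0 0 i t) a j b ≡ c * termCoeff t a j b
termCoeff-leftMul-unit c i (term c′ a′ b′ i′ j′) {a} {j} {b} = begin
  keepIf (b′ ≡ᵇ b) (keepIf (j′ ≡ᵇ j) (keepIf (a′ ≡ᵇ a) (c * c′)))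
    ≡⟨ cong (λ z → keepIf (b′ ≡ᵇ b) (keepIf (j′ ≡ᵇ j) z)) (keepIf-* (a′ ≡ᵇ a) c c′) ⟩
  keepIf (b′ ≡ᵇ b) (keepIf (j′ ≡ᵇ j) (c * keepIf (a′ ≡ᵇ a) c′))
    ≡⟨ cong (keepIf (b′ ≡ᵇ b)) (keepIf-* (j′ ≡ᵇ j) c _) ⟩
  keepIf (b′ ≡ᵇ b) (c * keepIf (j′ ≡ᵇ j) (keepIf (a′ ≡ᵇ a) c′))
    ≡⟨ keepIf-* (b′ ≡ᵇ b) c _ ⟩
  c * keepIf (b′ ≡ᵇ b) (keepIf (j′ ≡ᵇ j) (keepIf (a′ ≡ᵇ a) c′)) ∎

coeff-mulE-top : ∀ c a b i j m → coeff (mulE (term c a b i j)) a j m ≡ qintTimes (suc j) (λ x → keepIf (b ≡ᵇ x) c) m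
coeff-mulE-top c (suc a) b i j m = trans
  (coeff-map-cong (leftMul c (suc a) b i) (leftMul c a b i) (DjE j) (λ { (term c′ a′ b′ i′ j′) → refl }))
  (coeff-mulE-top c a b i j m)
coeff-mulE-top c zero (suc b) i j zero =
  coeff-map-0ℤ (leftMul c 0 (suc b) i) (DjE j) (λ { (term c′ a′ b′ i′ j′) → refl })
coeff-mulE-top c zero (suc b) i j (suc m) = begin
  coeff (mulE (term c 0 (suc b) i j)) 0 j (suc m)
    ≡⟨ coeff-map-cong (leftMul c 0 (suc b) i) (leftMul c 0 b i) (DjE j) (λ { (term c′ a′ b′ i′ j′) → refl }) ⟩
  coeff (mulE (term c 0 b i j)) 0 j m
    ≡⟨ coeff-mulE-top c 0 b i j m ⟩
  qintTimes (suc j) (λ x → keepIf (b ≡ᵇ x) c) m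
    ≡⟨ sym (qintTimes-suc (suc j) (λ x → keepIf (suc b ≡ᵇ x) c) refl m) ⟩
  qintTimes (suc j) (λ x → keepIf (suc b ≡ᵇ x) c) (suc m) ∎
coeff-mulE-top c zero zero i j m = begin
  coeff (mulE (term c 0 0 i j)) 0 j m
    ≡⟨ coeff-map-* (leftMul c 0 0 i) c (DjE j) (λ t → termCoeff-leftMul-unit c i t) ⟩
  c * coeff (DjE j) 0 j m                          ≡⟨ cong (c *_) (coeff-DjE-top j m) ⟩
  c * qintTimes (suc j) (qcoeff (1ℤ ∷ [])) m       ≡⟨ *-qintTimes (suc j) c (qcoeff (1ℤ ∷ [])) m ⟩
  qintTimes (suc j) (λ x → c * qcoeff (1ℤ ∷ []) x) m ≡⟨ qintTimes-cong (suc j) c*δ m ⟩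
  qintTimes (suc j) (λ x → keepIf (0 ≡ᵇ x) c) m    ∎
  where
  c*δ : ∀ x → c * qcoeff (1ℤ ∷ []) x ≡ keepIf (0 ≡ᵇ x) c
  c*δ zero    = *-identityʳ c
  c*δ (suc x) = *-zeroʳ c

coeff-mulE-diag : ∀ c a b i j k m → j ≤ a →
  coeff (mulE (term c a b i j)) k k m ≡ qintTimes (suc k) (termCoeff (term c a b i j) k k) m
coeff-mulE-diag c a b i j k m j≤a with a ≟ k | j ≟ a
... | no a≢k | _ = trans
  (coeff-vanishes (All.map (λ { {t} (yexp≡a , _) → termCoeff-yexp≢ t (λ yexp≡k → a≢k (trans (sym yexp≡a) yexp≡k)) })
                           (mulE-support c a b i j)))
  (sym (qintTimes-0ℤ (suc k) (λ x → termCoeff-yexp≢ (term c a b i j) a≢k) m))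
... | yes refl | no j≢a = trans
  (coeff-vanishes (All.map (λ { {t} (_ , dexp≤j) → termCoeff-dexp≢ t (ℕP.<⇒≢ (ℕP.≤-<-trans dexp≤j (ℕP.≤∧≢⇒< j≤a j≢a))) })
                           (mulE-support c a b i j)))
  (sym (qintTimes-0ℤ (suc a) (λ x → termCoeff-dexp≢ (term c a b i j) j≢a) m))
... | yes refl | yes refl = trans (coeff-mulE-top c a b i a m)
  (qintTimes-cong (suc a) (λ x → cong (λ z → keepIf (b ≡ᵇ x) (keepIf z (keepIf z c))) (sym (≡ᵇ-refl a))) m)

-- Each factor yD contributes one y and one D, each factor E neither (D^j E only has terms with at most j D's).
yDEpow-support : ∀ N → All (λ t → Term.dexp t ≤ Term.yexp t × Term.yexp t ≤ N) (yDEpow N)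
yDEpow-support zero    = (z≤n , z≤n) ∷ []
yDEpow-support (suc N) = concat⁺ (map⁺ (All.map
  (λ { {term c a b i j} (j≤a , a≤N) →
         (s≤s j≤a , s≤s a≤N) ∷ All.map
           (λ { (yexp≡a , dexp≤j) → ℕP.≤-trans dexp≤j (ℕP.≤-trans j≤a (ℕP.≤-reflexive (sym yexp≡a)))
                                  , ℕP.≤-trans (ℕP.≤-reflexive yexp≡a) (ℕP.m≤n⇒m≤1+n a≤N) })
           (mulE-support c a b i j) })
  (yDEpow-support N)))

coeff-diag-times-yD+E : ∀ e → All (λ t → Term.dexp t ≤ Term.yexp t) e → ∀ k m →
  coeff (concatMap (λ t → mulYD t ∷ mulE t) e) k k m ≡ coeff (map mulYD e) k k m + qintTimes (suc k) (coeff e k k) m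
coeff-diag-times-yD+E [] [] k m = sym (trans (+-identityˡ _) (qintTimes-0ℤ (suc k) (λ x → refl) m))
coeff-diag-times-yD+E (t@(term c a b i j) ∷ e) (j≤a ∷ e-support) k m = begin
  tD + coeff (mulE t ++ concatMap (λ t → mulYD t ∷ mulE t) e) k k m
    ≡⟨ cong (tD +_) (coeff-++ (mulE t) _ k k m) ⟩
  tD + (coeff (mulE t) k k m + coeff (concatMap (λ t → mulYD t ∷ mulE t) e) k k m)
    ≡⟨ cong₂ (λ u v → tD + (u + v)) (coeff-mulE-diag c a b i j k m j≤a) (coeff-diag-times-yD+E e e-support k m) ⟩
  tD + (tE + (eD + eE))   ≡⟨ sym (+-assoc tD tE (eD + eE)) ⟩
  (tD + tE) + (eD + eE)   ≡⟨ interchange tD tE eD eE ⟩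
  (tD + eD) + (tE + eE)   ≡⟨ cong ((tD + eD) +_) (sym (qintTimes-+ (suc k) (termCoeff t k k) (coeff e k k) m)) ⟩
  (tD + eD) + qintTimes (suc k) (coeff (t ∷ e) k k) m ∎
  where
  tD = termCoeff (mulYD t) k k m
  eD = coeff (map mulYD e) k k m
  tE = qintTimes (suc k) (termCoeff t k k) m
  eE = qintTimes (suc k) (coeff e k k) m

zbarCoeff : ℕ → ℕ → ℕ → ℤ
zbarCoeff N k = coeff (yDEpow N) k k

zbarCoeff-suc : ∀ N k m →
  zbarCoeff (suc N) k m ≡ coeff (map mulYD (yDEpow N)) k k m + qintTimes (suc k) (zbarCoeff N k) m
zbarCoeff-suc N k m = coeff-diag-times-yD+E (yDEpow N) (All.map proj₁ (yDEpow-support N)) k m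

zbarCoeff-above : ∀ N k m → N < k → zbarCoeff N k m ≡ 0ℤ
zbarCoeff-above N k m N<k = coeff-vanishes
  (All.map (λ { {t} (_ , yexp≤N) → termCoeff-yexp≢ t (ℕP.<⇒≢ (ℕP.≤-<-trans yexp≤N N<k)) }) (yDEpow-support N))

zbarCoeff-suc-zero : ∀ N m → zbarCoeff (suc N) 0 m ≡ zbarCoeff N 0 m
zbarCoeff-suc-zero N m = begin
  zbarCoeff (suc N) 0 m
    ≡⟨ zbarCoeff-suc N 0 m ⟩
  coeff (map mulYD (yDEpow N)) 0 0 m + qintTimes 1 (zbarCoeff N 0) m
    ≡⟨ cong₂ _+_ (coeff-map-0ℤ mulYD (yDEpow N) (λ { (term c a b i j) → keepIf-0ℤ (b ≡ᵇ m) })) (qintTimes-1 (zbarCoeff N 0) m) ⟩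
  0ℤ + zbarCoeff N 0 m
    ≡⟨ +-identityˡ _ ⟩
  zbarCoeff N 0 m ∎

zbarCoeff-suc-suc : ∀ N k m →
  zbarCoeff (suc N) (suc k) m ≡ zbarCoeff N k m + qintTimes (suc (suc k)) (zbarCoeff N (suc k)) m
zbarCoeff-suc-suc N k m = trans (zbarCoeff-suc N (suc k) m)
  (cong (_+ qintTimes (suc (suc k)) (zbarCoeff N (suc k)) m)
        (coeff-map mulYD (yDEpow N) (λ { (term c a b i j) → refl })))

S2-diagonal : ∀ n → S2 (suc n) (suc n) ≡ 1ℤ ∷ []
S2-diagonal n with n ≟ 0 | n ≟ n
... | yes _ | _        = refl
... | no _  | yes _    = refl
... | no _  | no n≢n   = ⊥-elim (n≢n refl)

S2-recurrence : ∀ n k → k < n →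
  S2 (suc (suc n)) (suc (suc k)) ≡ S2 (suc n) (suc k) +P qint (suc (suc k)) *P S2 (suc n) (suc (suc k))
S2-recurrence n k k<n with suc k ≟ suc n
... | yes refl = ⊥-elim (ℕP.<-irrefl refl k<n)
... | no _     = refl

zbarCoeff≡S2 : ∀ N k → k ≤ N → ∀ m → zbarCoeff N k m ≡ qcoeff (S2 (suc N) (suc k)) m
zbarCoeff≡S2 zero    zero    z≤n       zero    = refl
zbarCoeff≡S2 zero    zero    z≤n       (suc m) = refl
zbarCoeff≡S2 (suc N) zero    z≤n       m       = trans (zbarCoeff-suc-zero N m) (zbarCoeff≡S2 N zero z≤n m)
zbarCoeff≡S2 (suc N) (suc k) (s≤s k≤N) m with ℕP.m≤n⇒m<n∨m≡n k≤N
... | inj₂ refl = begin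
  zbarCoeff (suc N) (suc N) m
    ≡⟨ zbarCoeff-suc-suc N N m ⟩
  zbarCoeff N N m + qintTimes (suc (suc N)) (zbarCoeff N (suc N)) m
    ≡⟨ cong₂ _+_ (zbarCoeff≡S2 N N ℕP.≤-refl m) (qintTimes-0ℤ (suc (suc N)) (λ x → zbarCoeff-above N (suc N) x ℕP.≤-refl) m) ⟩
  qcoeff (S2 (suc N) (suc N)) m + 0ℤ
    ≡⟨ +-identityʳ _ ⟩
  qcoeff (S2 (suc N) (suc N)) m
    ≡⟨ cong (λ p → qcoeff p m) (trans (S2-diagonal N) (sym (S2-diagonal (suc N)))) ⟩
  qcoeff (S2 (suc (suc N)) (suc (suc N))) m ∎
... | inj₁ k<N = begin
  zbarCoeff (suc N) (suc k) m
    ≡⟨ zbarCoeff-suc-suc N k m ⟩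
  zbarCoeff N k m + qintTimes (suc (suc k)) (zbarCoeff N (suc k)) m
    ≡⟨ cong₂ _+_ (zbarCoeff≡S2 N k k≤N m) (qintTimes-cong (suc (suc k)) (zbarCoeff≡S2 N (suc k) k<N) m) ⟩
  qcoeff (S2 (suc N) (suc k)) m + qintTimes (suc (suc k)) (qcoeff (S2 (suc N) (suc (suc k)))) m
    ≡⟨ sym (trans (qcoeff-+P (S2 (suc N) (suc k)) _ m) (cong (qcoeff (S2 (suc N) (suc k)) m +_) (qcoeff-qint-*P (suc (suc k)) (S2 (suc N) (suc (suc k))) m))) ⟩
  qcoeff (S2 (suc N) (suc k) +P qint (suc (suc k)) *P S2 (suc N) (suc (suc k))) m
    ≡⟨ cong (λ p → qcoeff p m) (sym (S2-recurrence N k k<N)) ⟩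
  qcoeff (S2 (suc (suc N)) (suc (suc k))) m ∎

selectDiag : ℕ → Term → QPoly → QPoly
selectDiag k t acc = if ⌊ Term.dexp t ≟ k ⌋ ∧ ⌊ Term.yexp t ≟ k ⌋
                     then monoP (Term.coef t) (Term.qexp t) +P acc
                     else acc

qcoeff-if-monoP : ∀ B₁ B₂ c b acc m →
  qcoeff (if B₁ ∧ B₂ then monoP c b +P acc else acc) m ≡ keepIf (b ≡ᵇ m) (keepIf B₁ (keepIf B₂ c)) + qcoeff acc m
qcoeff-if-monoP true  true  c b acc m = trans (qcoeff-+P (monoP c b) acc m) (cong (_+ qcoeff acc m) (qcoeff-monoP c b m))
qcoeff-if-monoP true  false c b acc m = sym (trans (cong (_+ qcoeff acc m) (keepIf-0ℤ (b ≡ᵇ m))) (+-identityˡ _))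
qcoeff-if-monoP false B₂    c b acc m = sym (trans (cong (_+ qcoeff acc m) (keepIf-0ℤ (b ≡ᵇ m))) (+-identityˡ _))

qcoeff-selectDiag : ∀ k t acc m → qcoeff (selectDiag k t acc) m ≡ termCoeff t k k m + qcoeff acc m
qcoeff-selectDiag k (term c a b i j) acc m = trans (qcoeff-if-monoP ⌊ j ≟ k ⌋ ⌊ a ≟ k ⌋ c b acc m)
  (cong₂ (λ B₁ B₂ → keepIf (b ≡ᵇ m) (keepIf B₁ (keepIf B₂ c)) + qcoeff acc m) (⌊≟⌋≡≡ᵇ j k) (⌊≟⌋≡≡ᵇ a k))

qcoeff-foldr-selectDiag : ∀ k e m → qcoeff (foldr (selectDiag k) [] e) m ≡ coeff e k k m
qcoeff-foldr-selectDiag k []      m = refl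
qcoeff-foldr-selectDiag k (t ∷ e) m =
  trans (qcoeff-selectDiag k t _ m) (cong (termCoeff t k k m +_) (qcoeff-foldr-selectDiag k e m))

proposition7p1 : (N k : ℕ) → k ≤ N → (m : ℕ) →
    qcoeff (coeffβkyk-Zbar1 N k) m ≡ qcoeff (S2 (suc N) (suc k)) m
proposition7p1 N k k≤N m = trans (qcoeff-foldr-selectDiag k (yDEpow N) m) (zbarCoeff≡S2 N k k≤N m)
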